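{- Let $H$ and $G$ be connected finite simple graphs such that $J(G)\neq J(C_3)$ and $J(H)\neq J(C_3)$. If $J(H)$ is an induced subgraph of $J(G)$, then $H$ is a subgraph of $G$.
   Context: The jump graph $J(G)$ of a graph $G$ has vertex set $E(G)$, and two vertices of $J(G)$ are adjacent iff the corresponding edges of $G$ share no endpoint. $C_3$ is the triangle, so $J(C_3)$ is the graph with three vertices and no edges. Graphs are considered up to isomorphism. -}

module Defs where

open import Data.Nat using (ℕ)
open import Data.Fin using (Fin; _<_; _≟_)
open import Data.Bool using (Bool; true; false; not; _∨_)
open import Data.Product using (Σ; ∃; _×_; _,_; proj₁; proj₂)
open import Relation.Nullary using (yes; no)
open import Relation.Nullary.Decidable using (⌊_⌋)
open import Relation.Binary.PropositionalEquality using (_≡_; refl; sym; cong)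
open import Function.Definitions using (Injective)

record Graph (V : Set) : Set where
  field
    adj    : V → V → Bool
    adjSym : ∀ u v → adj u v ≡ adj v u
    irrefl : ∀ v → adj v v ≡ false
open Graph public

FinGraph : ℕ → Set
FinGraph n = Graph (Fin n)

_==_ : ∀ {n} → Fin n → Fin n → Bool
a == b = ⌊ a ≟ b ⌋

==-sym : ∀ {n} (a b : Fin n) → (a == b) ≡ (b == a)
==-sym a b with a ≟ b | b ≟ a
... | yes _ | yes _ = refl
... | no _  | no _  = refl
... | yes p | no q  with q (sym p)
... | ()
==-sym a b | no q | yes p with q (sym p)
... | ()

==-refl : ∀ {n} (a : Fin n) → (a == a) ≡ true
==-refl a with a ≟ a
... | yes _ = refl
... | no q with q refl
... | ()

-- Edges of a finite simple graph: unordered pairs {u,v}, represented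
-- canonically as (u , v) with u < v, such that u and v are adjacent.
Edge : ∀ {n} → FinGraph n → Set
Edge {n} G = Σ (Fin n × Fin n) λ p → (proj₁ p < proj₂ p) × (adj G (proj₁ p) (proj₂ p) ≡ true)

shares : ∀ {n} {G : FinGraph n} → Edge G → Edge G → Bool
shares ((u , v) , _) ((u' , v') , _) = (u == u') ∨ (u == v') ∨ (v == u') ∨ (v == v')

private
  swap-mid : ∀ a b c d → (a ∨ b ∨ c ∨ d) ≡ (a ∨ c ∨ b ∨ d)
  swap-mid true  b c d = refl
  swap-mid false true true d = refl
  swap-mid false true false d = refl
  swap-mid false false true d = refl
  swap-mid false false false d = refl

shares-sym : ∀ {n} {G : FinGraph n} (e f : Edge G) → shares {G = G} e f ≡ shares {G = G} f e
shares-sym ((u , v) , _) ((u' , v') , _)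
  rewrite ==-sym u' u | ==-sym u' v | ==-sym v' u | ==-sym v' v
  = swap-mid (u == u') (u == v') (v == u') (v == v')

shares-refl : ∀ {n} {G : FinGraph n} (e : Edge G) → shares {G = G} e e ≡ true
shares-refl ((u , v) , _) rewrite ==-refl u = refl

J : ∀ {n} (G : FinGraph n) → Graph (Edge G)
J G = record
  { adj    = λ e f → not (shares {G = G} e f)
  ; adjSym = λ e f → cong not (shares-sym {G = G} e f)
  ; irrefl = λ e → cong not (shares-refl {G = G} e)
  }

C₃ : FinGraph 3
C₃ = record
  { adj    = λ i j → not (i == j)
  ; adjSym = λ i j → cong not (==-sym i j)
  ; irrefl = λ i → cong not (==-refl i)
  }

data Walk {V : Set} (G : Graph V) : V → V → Set where
  here : ∀ {v} → Walk G v v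
  step : ∀ {u w v} → adj G u w ≡ true → Walk G w v → Walk G u v

Connected : ∀ {V : Set} → Graph V → Set
Connected {V} G = V × (∀ u v → Walk G u v)

record _≅_ {V W : Set} (A : Graph V) (B : Graph W) : Set where
  field
    to      : V → W
    from    : W → V
    from∘to : ∀ x → from (to x) ≡ x
    to∘from : ∀ y → to (from y) ≡ y
    adj≡    : ∀ x y → adj B (to x) (to y) ≡ adj A x y

IsInducedSubgraph : ∀ {V W : Set} → Graph V → Graph W → Set
IsInducedSubgraph {V} {W} A B =
  Σ (V → W) λ f → Injective _≡_ _≡_ f × (∀ x y → adj B (f x) (f y) ≡ adj A x y)

IsSubgraph : ∀ {V W : Set} → Graph V → Graph W → Set
IsSubgraph {V} {W} A B =
  Σ (V → W) λ f → Injective _≡_ _≡_ f × (∀ x y → adj A x y ≡ true → adj B (f x) (f y) ≡ true)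

-- The edges of H at a vertex pairwise share an endpoint, so their images under the induced
-- embedding of jump graphs do too, and three pairwise meeting edges of G either pass through a
-- common vertex or form a triangle.  If the edges at some vertex v of H are sent onto a triangle,
-- connectivity confines H to v, its three neighbours and edges between these neighbours; as H is not
-- the claw, one such edge exists, and its image is a pendant edge of the triangle, which yields an
-- explicit embedding of H on four vertices.  Otherwise (and H has at least three vertices) each
-- vertex v gets a centre: a vertex of G lying on the image of an edge e exactly when v lies on e.
-- For a vertex of degree one this uses the edge beyond its neighbour; a triangle of H whose images
-- pass through one vertex is ruled out because H is connected and is not C₃.  Mapping each vertex
-- to its centre embeds H in G.
module Submission where

open import Defs
open import Data.Nat using (ℕ; zero; suc; _+_; z≤n; s≤s)
open import Data.Fin using (Fin; zero; suc; _<_)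
open import Data.Fin.Properties using (_≟_; _<?_; <-cmp; <-irrelevant; <-asym; <-irrefl; any?)
open import Data.Bool using (true; false; T; not; _∨_)
open import Data.Bool.Properties using (T-≡; T-∨; not-injective) renaming (_≟_ to _≟ᵇ_)
open import Data.Product using (Σ; ∃; ∃₂; ∃-syntax; _×_; _,_; proj₁; proj₂)
open import Data.Sum using (_⊎_; inj₁; inj₂; [_,_])
import Data.Sum as Sum
open import Data.Empty using (⊥; ⊥-elim)
open import Function using (_∘_)
open import Function.Bundles using (_⇔_; _↔_; mk⇔; mk↔ₛ′; Equivalence; Inverse)
open import Function.Definitions using (Injective)
open import Function.Properties.Inverse using (↔-sym; ↔-trans)
open import Relation.Nullary using (¬_; Dec; yes; no)
open import Relation.Nullary.Decidable using (map′; _×-dec_; _⊎-dec_; ¬?; toWitness; fromWitness)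
open import Relation.Nullary.Irrelevant using (Irrelevant)
open import Relation.Binary.Definitions using (DecidableEquality; tri<; tri≈; tri>)
open import Relation.Binary.PropositionalEquality
  using (_≡_; _≢_; refl; sym; trans; cong; subst; subst₂; ≢-sym)
open import Axiom.UniquenessOfIdentityProofs using (module Decidable⇒UIP)

Σ-irrelevant? : {A : Set} {B : A → Set} → Irrelevant A → Dec A → (∀ a → Dec (B a)) → Dec (Σ A B)
Σ-irrelevant? _         (no ¬a) _  = no (¬a ∘ proj₁)
Σ-irrelevant? {B = B} irr (yes a) B? = map′ (a ,_) (λ (a' , b) → subst B (irr a' a) b) (B? a)

module Edges {k : ℕ} (K : FinGraph k) where

  lower upper : Edge K → Fin k
  lower = proj₁ ∘ proj₁
  upper = proj₂ ∘ proj₁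

  lower<upper : ∀ e → lower e < upper e
  lower<upper = proj₁ ∘ proj₂

  lower≢upper : ∀ e → lower e ≢ upper e
  lower≢upper e eq = <-irrefl eq (lower<upper e)

  lower-adj-upper : ∀ e → adj K (lower e) (upper e) ≡ true
  lower-adj-upper = proj₂ ∘ proj₂

  adj-sym : ∀ {x y} → adj K x y ≡ true → adj K y x ≡ true
  adj-sym {x} {y} = trans (adjSym K y x)

  adj⇒≢ : ∀ {x y} → adj K x y ≡ true → x ≢ y
  adj⇒≢ {x} p refl with trans (sym p) (irrefl K x)
  ... | ()

  edge-≡ : ∀ {e e'} → lower e ≡ lower e' → upper e ≡ upper e' → e ≡ e'
  edge-≡ {_ , x<y , a} {_ , x<y' , a'} refl refl
    rewrite <-irrelevant x<y x<y' | Decidable⇒UIP.≡-irrelevant _≟ᵇ_ a a' = refl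

  _≟ₑ_ : DecidableEquality (Edge K)
  e ≟ₑ e' = map′ (λ (p , q) → edge-≡ p q) (λ eq → cong lower eq , cong upper eq)
                 ((lower e ≟ lower e') ×-dec (upper e ≟ upper e'))

  ∃-edge? : {P : Edge K → Set} → (∀ e → Dec (P e)) → Dec (∃ P)
  ∃-edge? P? =
    map′ (λ (x , y , x<y , a , p) → ((x , y) , x<y , a) , p)
         (λ (((x , y) , x<y , a) , p) → x , y , x<y , a , p)
         (any? λ x → any? λ y →
            Σ-irrelevant? <-irrelevant (x <? y) λ x<y →
            Σ-irrelevant? (Decidable⇒UIP.≡-irrelevant _≟ᵇ_) (adj K x y ≟ᵇ true) λ a →
            P? ((x , y) , x<y , a))

  infix 4 _∈ₑ_ _∉ₑ_ _∈ₑ?_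

  data _∈ₑ_ (x : Fin k) (e : Edge K) : Set where
    at-lower : x ≡ lower e → x ∈ₑ e
    at-upper : x ≡ upper e → x ∈ₑ e

  _∉ₑ_ : Fin k → Edge K → Set
  x ∉ₑ e = ¬ x ∈ₑ e

  _∈ₑ?_ : ∀ x e → Dec (x ∈ₑ e)
  x ∈ₑ? e = map′ [ at-lower , at-upper ] (λ { (at-lower p) → inj₁ p ; (at-upper p) → inj₂ p })
                 ((x ≟ lower e) ⊎-dec (x ≟ upper e))

  opposite : ∀ {x e} → x ∈ₑ e → Fin k
  opposite {e = e} (at-lower _) = upper e
  opposite {e = e} (at-upper _) = lower e

  opposite∈ : ∀ {x e} (p : x ∈ₑ e) → opposite p ∈ₑ e
  opposite∈ (at-lower _) = at-upper refl
  opposite∈ (at-upper _) = at-lower refl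

  opposite≢ : ∀ {x e} (p : x ∈ₑ e) → opposite p ≢ x
  opposite≢ {e = e} (at-lower p) q = lower≢upper e (trans (sym p) (sym q))
  opposite≢ {e = e} (at-upper p) q = lower≢upper e (trans q p)

  endpoint-cases : ∀ {x y z e} → x ∈ₑ e → y ∈ₑ e → x ≢ y → z ∈ₑ e → z ≡ x ⊎ z ≡ y
  endpoint-cases (at-lower p) (at-lower q) x≢y _ = ⊥-elim (x≢y (trans p (sym q)))
  endpoint-cases (at-upper p) (at-upper q) x≢y _ = ⊥-elim (x≢y (trans p (sym q)))
  endpoint-cases (at-lower p) (at-upper q) _ (at-lower r) = inj₁ (trans r (sym p))
  endpoint-cases (at-lower p) (at-upper q) _ (at-upper r) = inj₂ (trans r (sym q))
  endpoint-cases (at-upper p) (at-lower q) _ (at-lower r) = inj₂ (trans r (sym q))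
  endpoint-cases (at-upper p) (at-lower q) _ (at-upper r) = inj₁ (trans r (sym p))

  ∉-of-≢ : ∀ {x y z e} → x ∈ₑ e → y ∈ₑ e → x ≢ y → z ≢ x → z ≢ y → z ∉ₑ e
  ∉-of-≢ xe ye x≢y z≢x z≢y ze = [ z≢x , z≢y ] (endpoint-cases xe ye x≢y ze)

  orientation : ∀ {x y e} → x ∈ₑ e → y ∈ₑ e → x ≢ y →
                (x ≡ lower e × y ≡ upper e) ⊎ (x ≡ upper e × y ≡ lower e)
  orientation (at-lower p) (at-upper q) _   = inj₁ (p , q)
  orientation (at-upper p) (at-lower q) _   = inj₂ (p , q)
  orientation (at-lower p) (at-lower q) x≢y = ⊥-elim (x≢y (trans p (sym q)))
  orientation (at-upper p) (at-upper q) x≢y = ⊥-elim (x≢y (trans p (sym q)))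

  edge-unique : ∀ {x y e e'} → x ≢ y → x ∈ₑ e → y ∈ₑ e → x ∈ₑ e' → y ∈ₑ e' → e ≡ e'
  edge-unique {e = e} {e'} x≢y xe ye xe' ye' with orientation xe ye x≢y | orientation xe' ye' x≢y
  ... | inj₁ (refl , refl) | inj₁ (p , q) = edge-≡ p q
  ... | inj₂ (refl , refl) | inj₂ (p , q) = edge-≡ q p
  ... | inj₁ (refl , refl) | inj₂ (p , q) =
        ⊥-elim (<-asym (lower<upper e) (subst₂ _<_ (sym q) (sym p) (lower<upper e')))
  ... | inj₂ (refl , refl) | inj₁ (p , q) =
        ⊥-elim (<-asym (lower<upper e) (subst₂ _<_ (sym p) (sym q) (lower<upper e')))

  common-endpoint-unique : ∀ {x y e e'} → e ≢ e' → x ∈ₑ e → x ∈ₑ e' → y ∈ₑ e → y ∈ₑ e' → x ≡ y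
  common-endpoint-unique {x} {y} e≢e' xe xe' ye ye' with x ≟ y
  ... | yes x≡y = x≡y
  ... | no x≢y  = ⊥-elim (e≢e' (edge-unique x≢y xe ye xe' ye'))

  endpoints-adjacent : ∀ {x y e} → x ∈ₑ e → y ∈ₑ e → x ≢ y → adj K x y ≡ true
  endpoints-adjacent {e = e} xe ye x≢y with orientation xe ye x≢y
  ... | inj₁ (refl , refl) = lower-adj-upper e
  ... | inj₂ (refl , refl) = adj-sym (lower-adj-upper e)

  edge-through : ∀ {x y} → adj K x y ≡ true → Σ (Edge K) λ e → x ∈ₑ e × y ∈ₑ e
  edge-through {x} {y} p with <-cmp x y
  ... | tri< x<y _ _ = ((x , y) , x<y , p) , at-lower refl , at-upper refl
  ... | tri≈ _ x≡y _ = ⊥-elim (adj⇒≢ p x≡y)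
  ... | tri> _ _ y<x = ((y , x) , y<x , adj-sym p) , at-upper refl , at-lower refl

  Share : Edge K → Edge K → Set
  Share e e' = ∃[ x ] x ∈ₑ e × x ∈ₑ e'

  Share-sym : ∀ {e e'} → Share e e' → Share e' e
  Share-sym (x , xe , xe') = x , xe' , xe

  private
    T-∨₄ : ∀ {a b c d} → T (a ∨ b ∨ c ∨ d) ⇔ (T a ⊎ T b ⊎ T c ⊎ T d)
    T-∨₄ = mk⇔ (Sum.map₂ (Sum.map₂ (Equivalence.to T-∨) ∘ Equivalence.to T-∨) ∘ Equivalence.to T-∨)
               (Equivalence.from T-∨ ∘ Sum.map₂ (Equivalence.from T-∨ ∘ Sum.map₂ (Equivalence.from T-∨)))

  Share⇒shares : ∀ {e e'} → Share e e' → shares {G = K} e e' ≡ true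
  Share⇒shares {e} {e'} (x , xe , xe') = Equivalence.to T-≡ (Equivalence.from T-∨₄ (common xe xe'))
    where
      match : ∀ {a b} → a ≡ b → T (a == b)
      match {a} {b} = fromWitness {a? = a ≟ b}
      common : x ∈ₑ e → x ∈ₑ e' → T (lower e == lower e') ⊎ T (lower e == upper e')
                                  ⊎ T (upper e == lower e') ⊎ T (upper e == upper e')
      common (at-lower p) (at-lower q) = inj₁ (match (trans (sym p) q))
      common (at-lower p) (at-upper q) = inj₂ (inj₁ (match (trans (sym p) q)))
      common (at-upper p) (at-lower q) = inj₂ (inj₂ (inj₁ (match (trans (sym p) q))))
      common (at-upper p) (at-upper q) = inj₂ (inj₂ (inj₂ (match (trans (sym p) q))))

  shares⇒Share : ∀ {e e'} → shares {G = K} e e' ≡ true → Share e e'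
  shares⇒Share {e} {e'} s with Equivalence.to T-∨₄ (Equivalence.from T-≡ s)
  ... | inj₁ t               = lower e , at-lower refl , at-lower (toWitness {a? = lower e ≟ lower e'} t)
  ... | inj₂ (inj₁ t)        = lower e , at-lower refl , at-upper (toWitness {a? = lower e ≟ upper e'} t)
  ... | inj₂ (inj₂ (inj₁ t)) = upper e , at-upper refl , at-lower (toWitness {a? = upper e ≟ lower e'} t)
  ... | inj₂ (inj₂ (inj₂ t)) = upper e , at-upper refl , at-upper (toWitness {a? = upper e ≟ upper e'} t)

  Share-∉⇒∈ : ∀ {X Y p q} → Share X Y → p ∈ₑ Y → q ∈ₑ Y → p ≢ q → p ∉ₑ X → q ∈ₑ X
  Share-∉⇒∈ (y , yX , yY) pY qY p≢q p∉X with endpoint-cases pY qY p≢q yY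
  ... | inj₁ refl = ⊥-elim (p∉X yX)
  ... | inj₂ refl = yX

  ¬Share-of-∉ : ∀ {X Y p q} → p ∈ₑ Y → q ∈ₑ Y → p ≢ q → p ∉ₑ X → q ∉ₑ X → ¬ Share X Y
  ¬Share-of-∉ pY qY p≢q p∉X q∉X S = q∉X (Share-∉⇒∈ S pY qY p≢q p∉X)

  ¬Share-of-≢ : ∀ {X Y a b p q} → a ∈ₑ X → b ∈ₑ X → a ≢ b → p ∈ₑ Y → q ∈ₑ Y → p ≢ q →
                p ≢ a → p ≢ b → q ≢ a → q ≢ b → ¬ Share X Y
  ¬Share-of-≢ aX bX a≢b pY qY p≢q p≢a p≢b q≢a q≢b =
    ¬Share-of-∉ pY qY p≢q (∉-of-≢ aX bX a≢b p≢a p≢b) (∉-of-≢ aX bX a≢b q≢a q≢b)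

  opposites-≢ : ∀ {x e e'} (p : x ∈ₑ e) (q : x ∈ₑ e') → e ≢ e' → opposite p ≢ opposite q
  opposites-≢ p q e≢e' eq =
    e≢e' (edge-unique (≢-sym (opposite≢ p)) p (opposite∈ p) q (subst (_∈ₑ _) (sym eq) (opposite∈ q)))

  NoCommonEndpoint : Edge K → Edge K → Edge K → Set
  NoCommonEndpoint e₁ e₂ e₃ = ¬ (∃[ x ] x ∈ₑ e₁ × x ∈ₑ e₂ × x ∈ₑ e₃)

  noCommonEndpoint? : ∀ e₁ e₂ e₃ → Dec (NoCommonEndpoint e₁ e₂ e₃)
  noCommonEndpoint? e₁ e₂ e₃ = ¬? (any? λ x → (x ∈ₑ? e₁) ×-dec (x ∈ₑ? e₂) ×-dec (x ∈ₑ? e₃))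

  -- Eᵢ is the side opposite the corner aᵢ.
  record Triangle (E₁ E₂ E₃ : Edge K) : Set where
    field
      a₁ a₂ a₃ : Fin k
      a₁≢a₂ : a₁ ≢ a₂
      a₁≢a₃ : a₁ ≢ a₃
      a₂≢a₃ : a₂ ≢ a₃
      a₂∈E₁ : a₂ ∈ₑ E₁
      a₃∈E₁ : a₃ ∈ₑ E₁
      a₁∈E₂ : a₁ ∈ₑ E₂
      a₃∈E₂ : a₃ ∈ₑ E₂
      a₁∈E₃ : a₁ ∈ₑ E₃
      a₂∈E₃ : a₂ ∈ₑ E₃

    Corner : Fin k → Set
    Corner z = z ≡ a₁ ⊎ z ≡ a₂ ⊎ z ≡ a₃

    corner? : ∀ z → Dec (Corner z)
    corner? z = (z ≟ a₁) ⊎-dec (z ≟ a₂) ⊎-dec (z ≟ a₃)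

    E₁≢E₂ : E₁ ≢ E₂
    E₁≢E₂ eq = ∉-of-≢ a₂∈E₁ a₃∈E₁ a₂≢a₃ a₁≢a₂ a₁≢a₃ (subst (a₁ ∈ₑ_) (sym eq) a₁∈E₂)

    E₁≢E₃ : E₁ ≢ E₃
    E₁≢E₃ eq = ∉-of-≢ a₂∈E₁ a₃∈E₁ a₂≢a₃ a₁≢a₂ a₁≢a₃ (subst (a₁ ∈ₑ_) (sym eq) a₁∈E₃)

    E₂≢E₃ : E₂ ≢ E₃
    E₂≢E₃ eq = ∉-of-≢ a₁∈E₂ a₃∈E₂ a₁≢a₃ (≢-sym a₁≢a₂) a₂≢a₃ (subst (a₂ ∈ₑ_) (sym eq) a₂∈E₃)

    through-a₃ : ∀ {X} → Share X E₁ → ¬ Share X E₃ → a₃ ∈ₑ X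
    through-a₃ S ¬S = Share-∉⇒∈ S a₂∈E₁ a₃∈E₁ a₂≢a₃ (λ a₂∈X → ¬S (a₂ , a₂∈X , a₂∈E₃))

    ¬meets-only-E₁ : ∀ {X} → Share X E₁ → ¬ Share X E₂ → ¬ Share X E₃ → ⊥
    ¬meets-only-E₁ S ¬S₂ ¬S₃ = ¬S₂ (a₃ , through-a₃ S ¬S₃ , a₃∈E₂)

    meets-all-sides⇒side : ∀ {X} → Share X E₁ → Share X E₂ → Share X E₃ → X ≡ E₁ ⊎ X ≡ E₂ ⊎ X ≡ E₃
    meets-all-sides⇒side {X} S₁ S₂ (y , yX , yE₃) with a₃ ∈ₑ? X
    ... | no a₃∉X = inj₂ (inj₂ (edge-unique a₁≢a₂
          (Share-∉⇒∈ S₂ a₃∈E₂ a₁∈E₂ (≢-sym a₁≢a₃) a₃∉X)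
          (Share-∉⇒∈ S₁ a₃∈E₁ a₂∈E₁ (≢-sym a₂≢a₃) a₃∉X) a₁∈E₃ a₂∈E₃))
    ... | yes a₃∈X with endpoint-cases a₁∈E₃ a₂∈E₃ a₁≢a₂ yE₃
    ...   | inj₁ refl = inj₂ (inj₁ (edge-unique a₁≢a₃ yX a₃∈X a₁∈E₂ a₃∈E₂))
    ...   | inj₂ refl = inj₁ (edge-unique a₂≢a₃ yX a₃∈X a₂∈E₁ a₃∈E₁)

    side-through-corners : ∀ {X y z} → Corner y → Corner z → y ≢ z → y ∈ₑ X → z ∈ₑ X →
                           X ≡ E₁ ⊎ X ≡ E₂ ⊎ X ≡ E₃
    side-through-corners (inj₁ refl)        (inj₁ refl)        y≢z _  _  = ⊥-elim (y≢z refl)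
    side-through-corners (inj₂ (inj₁ refl)) (inj₂ (inj₁ refl)) y≢z _  _  = ⊥-elim (y≢z refl)
    side-through-corners (inj₂ (inj₂ refl)) (inj₂ (inj₂ refl)) y≢z _  _  = ⊥-elim (y≢z refl)
    side-through-corners (inj₁ refl)        (inj₂ (inj₁ refl)) _   yX zX = inj₂ (inj₂ (edge-unique a₁≢a₂ yX zX a₁∈E₃ a₂∈E₃))
    side-through-corners (inj₂ (inj₁ refl)) (inj₁ refl)        _   yX zX = inj₂ (inj₂ (edge-unique a₁≢a₂ zX yX a₁∈E₃ a₂∈E₃))
    side-through-corners (inj₁ refl)        (inj₂ (inj₂ refl)) _   yX zX = inj₂ (inj₁ (edge-unique a₁≢a₃ yX zX a₁∈E₂ a₃∈E₂))
    side-through-corners (inj₂ (inj₂ refl)) (inj₁ refl)        _   yX zX = inj₂ (inj₁ (edge-unique a₁≢a₃ zX yX a₁∈E₂ a₃∈E₂))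
    side-through-corners (inj₂ (inj₁ refl)) (inj₂ (inj₂ refl)) _   yX zX = inj₁ (edge-unique a₂≢a₃ yX zX a₂∈E₁ a₃∈E₁)
    side-through-corners (inj₂ (inj₂ refl)) (inj₂ (inj₁ refl)) _   yX zX = inj₁ (edge-unique a₂≢a₃ zX yX a₂∈E₁ a₃∈E₁)

  swap₁₂ : ∀ {E₁ E₂ E₃} → Triangle E₁ E₂ E₃ → Triangle E₂ E₁ E₃
  swap₁₂ T = record
    { a₁ = a₂ ; a₂ = a₁ ; a₃ = a₃
    ; a₁≢a₂ = ≢-sym a₁≢a₂ ; a₁≢a₃ = a₂≢a₃ ; a₂≢a₃ = a₁≢a₃
    ; a₂∈E₁ = a₁∈E₂ ; a₃∈E₁ = a₃∈E₂ ; a₁∈E₂ = a₂∈E₁ ; a₃∈E₂ = a₃∈E₁ ; a₁∈E₃ = a₂∈E₃ ; a₂∈E₃ = a₁∈E₃ }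
    where open Triangle T

  swap₂₃ : ∀ {E₁ E₂ E₃} → Triangle E₁ E₂ E₃ → Triangle E₁ E₃ E₂
  swap₂₃ T = record
    { a₁ = a₁ ; a₂ = a₃ ; a₃ = a₂
    ; a₁≢a₂ = a₁≢a₃ ; a₁≢a₃ = a₁≢a₂ ; a₂≢a₃ = ≢-sym a₂≢a₃
    ; a₂∈E₁ = a₃∈E₁ ; a₃∈E₁ = a₂∈E₁ ; a₁∈E₂ = a₁∈E₃ ; a₃∈E₂ = a₂∈E₃ ; a₁∈E₃ = a₁∈E₂ ; a₂∈E₃ = a₃∈E₂ }
    where open Triangle T

  swap₁₃ : ∀ {E₁ E₂ E₃} → Triangle E₁ E₂ E₃ → Triangle E₃ E₂ E₁
  swap₁₃ = swap₁₂ ∘ swap₂₃ ∘ swap₁₂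

  triangle-of-pairwise-Share : ∀ {E₁ E₂ E₃} → E₁ ≢ E₂ → Share E₁ E₂ → Share E₁ E₃ → Share E₂ E₃ →
                               NoCommonEndpoint E₁ E₂ E₃ → Triangle E₁ E₂ E₃
  triangle-of-pairwise-Share {E₁} {E₂} {E₃} E₁≢E₂ (c , cE₁ , cE₂) S₁₃ S₂₃ no-common = record
    { a₁ = opposite cE₂ ; a₂ = opposite cE₁ ; a₃ = c
    ; a₁≢a₂ = λ eq → E₁≢E₂ (edge-unique (≢-sym (opposite≢ cE₁)) cE₁ (opposite∈ cE₁) cE₂
                                         (subst (_∈ₑ E₂) eq (opposite∈ cE₂)))
    ; a₁≢a₃ = opposite≢ cE₂ ; a₂≢a₃ = opposite≢ cE₁
    ; a₂∈E₁ = opposite∈ cE₁ ; a₃∈E₁ = cE₁ ; a₁∈E₂ = opposite∈ cE₂ ; a₃∈E₂ = cE₂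
    ; a₁∈E₃ = Share-∉⇒∈ (Share-sym S₂₃) cE₂ (opposite∈ cE₂) (≢-sym (opposite≢ cE₂)) c∉E₃
    ; a₂∈E₃ = Share-∉⇒∈ (Share-sym S₁₃) cE₁ (opposite∈ cE₁) (≢-sym (opposite≢ cE₁)) c∉E₃ }
    where
      c∉E₃ : c ∉ₑ E₃
      c∉E₃ cE₃ = no-common (c , cE₁ , cE₂ , cE₃)

  record ThreeMeetingEdges : Set where
    field
      e₁ e₂ e₃ : Edge K
      e₁≢e₂ : e₁ ≢ e₂
      e₁≢e₃ : e₁ ≢ e₃
      e₂≢e₃ : e₂ ≢ e₃
      Share₁₂ : Share e₁ e₂
      Share₁₃ : Share e₁ e₃
      Share₂₃ : Share e₂ e₃
      all-edges : ∀ e → e ≡ e₁ ⊎ e ≡ e₂ ⊎ e ≡ e₃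

    Share-all : ∀ e e' → Share e e'
    Share-all e e' with all-edges e | all-edges e'
    ... | inj₁ refl        | inj₁ refl        = lower e , at-lower refl , at-lower refl
    ... | inj₂ (inj₁ refl) | inj₂ (inj₁ refl) = lower e , at-lower refl , at-lower refl
    ... | inj₂ (inj₂ refl) | inj₂ (inj₂ refl) = lower e , at-lower refl , at-lower refl
    ... | inj₁ refl        | inj₂ (inj₁ refl) = Share₁₂
    ... | inj₁ refl        | inj₂ (inj₂ refl) = Share₁₃
    ... | inj₂ (inj₁ refl) | inj₂ (inj₂ refl) = Share₂₃
    ... | inj₂ (inj₁ refl) | inj₁ refl        = Share-sym Share₁₂
    ... | inj₂ (inj₂ refl) | inj₁ refl        = Share-sym Share₁₃
    ... | inj₂ (inj₂ refl) | inj₂ (inj₁ refl) = Share-sym Share₂₃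

  triangle⇒ThreeMeetingEdges : ∀ {E₁ E₂ E₃} (T : Triangle E₁ E₂ E₃) → (∀ z → Triangle.Corner T z) →
                               ThreeMeetingEdges
  triangle⇒ThreeMeetingEdges {E₁} {E₂} {E₃} T corners = record
    { e₁ = E₁ ; e₂ = E₂ ; e₃ = E₃
    ; e₁≢e₂ = E₁≢E₂ ; e₁≢e₃ = E₁≢E₃ ; e₂≢e₃ = E₂≢E₃
    ; Share₁₂ = a₃ , a₃∈E₁ , a₃∈E₂ ; Share₁₃ = a₂ , a₂∈E₁ , a₂∈E₃ ; Share₂₃ = a₁ , a₁∈E₂ , a₁∈E₃
    ; all-edges = λ e → side-through-corners (corners (lower e)) (corners (upper e)) (lower≢upper e)
                                             (at-lower refl) (at-upper refl) }
    where open Triangle T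

Edgeless : ∀ {V} → Graph V → Set
Edgeless A = ∀ x y → adj A x y ≡ false

≅-of-edgeless : ∀ {V W} {A : Graph V} {B : Graph W} → Edgeless A → Edgeless B → V ↔ W → A ≅ B
≅-of-edgeless ∅A ∅B V↔W = record
  { to = to ; from = from ; from∘to = strictlyInverseʳ ; to∘from = strictlyInverseˡ
  ; adj≡ = λ x y → trans (∅B (to x) (to y)) (sym (∅A x y)) }
  where open Inverse V↔W

↔-Fin3 : ∀ {A : Set} {a b c : A} → a ≢ b → a ≢ c → b ≢ c → (∀ x → x ≡ a ⊎ x ≡ b ⊎ x ≡ c) → A ↔ Fin 3
↔-Fin3 {A} {a} {b} {c} a≢b a≢c b≢c cover = mk↔ₛ′ (index ∘ cover) element index-element element-index
  where
    index : ∀ {x} → x ≡ a ⊎ x ≡ b ⊎ x ≡ c → Fin 3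
    index (inj₁ _)        = zero
    index (inj₂ (inj₁ _)) = suc zero
    index (inj₂ (inj₂ _)) = suc (suc zero)

    element : Fin 3 → A
    element zero             = a
    element (suc zero)       = b
    element (suc (suc zero)) = c

    element-index : ∀ x → element (index (cover x)) ≡ x
    element-index x with cover x
    ... | inj₁ x≡a        = sym x≡a
    ... | inj₂ (inj₁ x≡b) = sym x≡b
    ... | inj₂ (inj₂ x≡c) = sym x≡c

    index-element : ∀ i → index (cover (element i)) ≡ i
    index-element zero with cover a
    ... | inj₁ _          = refl
    ... | inj₂ (inj₁ a≡b) = ⊥-elim (a≢b a≡b)
    ... | inj₂ (inj₂ a≡c) = ⊥-elim (a≢c a≡c)
    index-element (suc zero) with cover b
    ... | inj₁ b≡a        = ⊥-elim (a≢b (sym b≡a))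
    ... | inj₂ (inj₁ _)   = refl
    ... | inj₂ (inj₂ b≡c) = ⊥-elim (b≢c b≡c)
    index-element (suc (suc zero)) with cover c
    ... | inj₁ c≡a        = ⊥-elim (a≢c (sym c≡a))
    ... | inj₂ (inj₁ c≡b) = ⊥-elim (b≢c (sym c≡b))
    ... | inj₂ (inj₂ _)   = refl

module _ {k : ℕ} {K : FinGraph k} (t : Edges.ThreeMeetingEdges K) where
  open Edges K
  open ThreeMeetingEdges t

  J-edgeless : Edgeless (J K)
  J-edgeless e e' = cong not (Share⇒shares (Share-all e e'))

  Edges↔Fin3 : Edge K ↔ Fin 3
  Edges↔Fin3 = ↔-Fin3 e₁≢e₂ e₁≢e₃ e₂≢e₃ all-edges

J≅J : ∀ {k l} {K : FinGraph k} {L : FinGraph l} →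
      Edges.ThreeMeetingEdges K → Edges.ThreeMeetingEdges L → J K ≅ J L
J≅J tK tL = ≅-of-edgeless (J-edgeless tK) (J-edgeless tL) (↔-trans (Edges↔Fin3 tK) (↔-sym (Edges↔Fin3 tL)))

C₃-edges : Edges.ThreeMeetingEdges C₃
C₃-edges = record
  { e₁ = c₀₁ ; e₂ = c₀₂ ; e₃ = c₁₂
  ; e₁≢e₂ = one≢two ∘ cong upper ; e₁≢e₃ = zero≢one ∘ cong lower ; e₂≢e₃ = zero≢one ∘ cong lower
  ; Share₁₂ = zero , at-lower refl , at-lower refl
  ; Share₁₃ = suc zero , at-upper refl , at-lower refl
  ; Share₂₃ = suc (suc zero) , at-upper refl , at-upper refl
  ; all-edges = all-edges }
  where
    open Edges C₃
    c₀₁ c₀₂ c₁₂ : Edge C₃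
    c₀₁ = (zero , suc zero) , s≤s z≤n , refl
    c₀₂ = (zero , suc (suc zero)) , s≤s z≤n , refl
    c₁₂ = (suc zero , suc (suc zero)) , s≤s (s≤s z≤n) , refl

    zero≢one : _≢_ {A = Fin 3} zero (suc zero)
    zero≢one ()

    one≢two : _≢_ {A = Fin 3} (suc zero) (suc (suc zero))
    one≢two ()

    all-edges : ∀ e → e ≡ c₀₁ ⊎ e ≡ c₀₂ ⊎ e ≡ c₁₂
    all-edges ((zero , zero) , () , _)
    all-edges ((zero , suc zero) , _) = inj₁ (edge-≡ refl refl)
    all-edges ((zero , suc (suc zero)) , _) = inj₂ (inj₁ (edge-≡ refl refl))
    all-edges ((suc zero , zero) , () , _)
    all-edges ((suc zero , suc zero) , s≤s () , _)
    all-edges ((suc zero , suc (suc zero)) , _) = inj₂ (inj₂ (edge-≡ refl refl))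
    all-edges ((suc (suc zero) , zero) , () , _)
    all-edges ((suc (suc zero) , suc zero) , s≤s () , _)
    all-edges ((suc (suc zero) , suc (suc zero)) , s≤s (s≤s ()) , _)

J≅JC₃ : ∀ {k} {K : FinGraph k} → Edges.ThreeMeetingEdges K → J K ≅ J C₃
J≅JC₃ t = J≅J t C₃-edges

module _ {V : Set} (K : Graph V) where

  walk-exit : ∀ {P : V → Set} {s t} → (∀ z → Dec (P z)) → Walk K s t → P s → ¬ P t →
              ∃₂ λ a b → P a × ¬ P b × adj K a b ≡ true
  walk-exit P? here ps ¬pt = ⊥-elim (¬pt ps)
  walk-exit P? (step {w = w} p walk) ps ¬pt with P? w
  ... | yes pw = walk-exit P? walk pw ¬pt
  ... | no ¬pw = _ , w , ps , ¬pw , p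

  walk-closed : ∀ {P : V → Set} {s t} → (∀ {a b} → P a → adj K a b ≡ true → P b) → Walk K s t → P s → P t
  walk-closed closed here ps = ps
  walk-closed closed (step p walk) ps = walk-closed closed walk (closed ps p)

  first-step : ∀ {s t} → Walk K s t → s ≢ t → ∃[ u ] adj K s u ≡ true
  first-step here s≢t = ⊥-elim (s≢t refl)
  first-step (step p _) _ = _ , p

leave-pair : ∀ {k} {K : FinGraph k} {a b z} → Walk K a z → z ≢ a → z ≢ b →
             ∃₂ λ x y → (x ≡ a ⊎ x ≡ b) × (y ≢ a × y ≢ b) × adj K x y ≡ true
leave-pair {K = K} {a} {b} walk z≢a z≢b
  with walk-exit K (λ x → (x ≟ a) ⊎-dec (x ≟ b)) walk (inj₁ refl) [ z≢a , z≢b ]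
... | x , y , x∈ , y∉ , xy = x , y , x∈ , (y∉ ∘ inj₁ , y∉ ∘ inj₂) , xy

avoid-two : ∀ {A : Set} → DecidableEquality A → {x y z : A} → x ≢ y → x ≢ z → y ≢ z →
            ∀ a b → ∃[ c ] c ≢ a × c ≢ b
avoid-two _≟_ {x} {y} {z} x≢y x≢z y≢z a b with x ≟ a | x ≟ b
... | no x≢a   | no x≢b = x , x≢a , x≢b
... | yes refl | _ with y ≟ b
...   | no y≢b   = y , ≢-sym x≢y , y≢b
...   | yes refl = z , ≢-sym x≢z , ≢-sym y≢z
avoid-two _≟_ {x} {y} {z} x≢y x≢z y≢z a b | no x≢a | yes refl with y ≟ a
...   | no y≢a   = y , y≢a , ≢-sym x≢y
...   | yes refl = z , ≢-sym y≢z , ≢-sym x≢z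

subgraph-by-enumeration : ∀ {I V W : Set} {A : Graph V} {B : Graph W} (t : I → V) (s : I → W) →
  (∀ z → ∃[ i ] t i ≡ z) → (∀ i j → s i ≡ s j → t i ≡ t j) →
  (∀ i j → adj A (t i) (t j) ≡ true → adj B (s i) (s j) ≡ true) → IsSubgraph A B
subgraph-by-enumeration {A = A} {B} t s cover reflects transfer = g , g-injective , g-adj
  where
    g = s ∘ proj₁ ∘ cover

    g-injective : Injective _≡_ _≡_ g
    g-injective {x} {y} gx≡gy with cover x | cover y
    ... | i , refl | j , refl = reflects i j gx≡gy

    g-adj : ∀ x y → adj A x y ≡ true → adj B (g x) (g y) ≡ true
    g-adj x y xy with cover x | cover y
    ... | i , refl | j , refl = transfer i j xy

subgraph-of-empty : ∀ {n} (H : FinGraph 0) (G : FinGraph n) → IsSubgraph H G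
subgraph-of-empty H G = (λ ()) , (λ { {()} }) , λ ()

subgraph-of-single : ∀ {n} (H : FinGraph 1) (G : FinGraph n) → Fin n → IsSubgraph H G
subgraph-of-single H G w =
  (λ _ → w) , (λ { {zero} {zero} _ → refl }) , λ { zero zero p → ⊥-elim (Edges.adj⇒≢ H p refl) }

subgraph-of-pair : ∀ {n} (H : FinGraph 2) (G : FinGraph n) → Edge G → IsSubgraph H G
subgraph-of-pair H G e = subgraph-by-enumeration {A = H} {B = G} (λ z → z) endpoint (λ z → z , refl) reflects transfer
  where
    open Edges G
    endpoint : Fin 2 → Fin _
    endpoint zero       = lower e
    endpoint (suc zero) = upper e

    reflects : ∀ i j → endpoint i ≡ endpoint j → i ≡ j
    reflects zero       zero       _  = refl
    reflects zero       (suc zero) eq = ⊥-elim (lower≢upper e eq)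
    reflects (suc zero) zero       eq = ⊥-elim (lower≢upper e (sym eq))
    reflects (suc zero) (suc zero) _  = refl

    transfer : ∀ i j → adj H i j ≡ true → adj G (endpoint i) (endpoint j) ≡ true
    transfer zero       zero       p = ⊥-elim (Edges.adj⇒≢ H p refl)
    transfer zero       (suc zero) _ = lower-adj-upper e
    transfer (suc zero) zero       _ = adj-sym (lower-adj-upper e)
    transfer (suc zero) (suc zero) p = ⊥-elim (Edges.adj⇒≢ H p refl)

module Reconstruction {k n : ℕ} (H : FinGraph (3 + k)) (G : FinGraph n)
  (connected : ∀ u v → Walk H u v) (J≇JC₃ : ¬ J H ≅ J C₃)
  (f : Edge H → Edge G) (f-injective : Injective _≡_ _≡_ f)
  (f-adj : ∀ e e' → adj (J G) (f e) (f e') ≡ adj (J H) e e') where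

  module H = Edges H
  module G = Edges G
  open H using () renaming (_∈ₑ_ to _∈H_; _∈ₑ?_ to _∈H?_)
  open G using () renaming (_∈ₑ_ to _∈G_; _∉ₑ_ to _∉G_; _∈ₑ?_ to _∈G?_)

  third : (a b : Fin (3 + k)) → ∃[ z ] z ≢ a × z ≢ b
  third = avoid-two _≟_ {x = zero} {suc zero} {suc (suc zero)} (λ ()) (λ ()) (λ ())

  -- Opaque: only the existence of the common endpoint is ever used, and unfolding these proofs
  -- makes checking the case analyses below prohibitively slow.
  opaque
    f-Share : ∀ {e e'} → H.Share e e' → G.Share (f e) (f e')
    f-Share {e} {e'} S = G.shares⇒Share (trans (not-injective (f-adj e e')) (H.Share⇒shares S))

    f-Share⁻¹ : ∀ {e e'} → G.Share (f e) (f e') → H.Share e e'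
    f-Share⁻¹ {e} {e'} S = H.shares⇒Share (trans (sym (not-injective (f-adj e e'))) (G.Share⇒shares S))

  f-¬Share : ∀ {e e'} → ¬ H.Share e e' → ¬ G.Share (f e) (f e')
  f-¬Share ¬S = ¬S ∘ f-Share⁻¹

  f-≢ : ∀ {e e'} → e ≢ e' → f e ≢ f e'
  f-≢ e≢e' = e≢e' ∘ f-injective

  record TriangularStar : Set where
    constructor triangularStar
    field
      centre : Fin (3 + k)
      e₁ e₂ e₃ : Edge H
      centre∈e₁ : centre ∈H e₁
      centre∈e₂ : centre ∈H e₂
      centre∈e₃ : centre ∈H e₃
      e₁≢e₂ : e₁ ≢ e₂
      e₁≢e₃ : e₁ ≢ e₃
      e₂≢e₃ : e₂ ≢ e₃
      images-no-common : G.NoCommonEndpoint (f e₁) (f e₂) (f e₃)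

  triangularStar? : Dec TriangularStar
  triangularStar? = map′
    (λ (v , e₁ , e₂ , e₃ , v₁ , v₂ , v₃ , d₁₂ , d₁₃ , d₂₃ , nc) → triangularStar v e₁ e₂ e₃ v₁ v₂ v₃ d₁₂ d₁₃ d₂₃ nc)
    (λ (triangularStar v e₁ e₂ e₃ v₁ v₂ v₃ d₁₂ d₁₃ d₂₃ nc) → v , e₁ , e₂ , e₃ , v₁ , v₂ , v₃ , d₁₂ , d₁₃ , d₂₃ , nc)
    (any? λ v → H.∃-edge? λ e₁ → H.∃-edge? λ e₂ → H.∃-edge? λ e₃ →
      (v ∈H? e₁) ×-dec (v ∈H? e₂) ×-dec (v ∈H? e₃) ×-dec
      ¬? (e₁ H.≟ₑ e₂) ×-dec ¬? (e₁ H.≟ₑ e₃) ×-dec ¬? (e₂ H.≟ₑ e₃) ×-dec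
      G.noCommonEndpoint? (f e₁) (f e₂) (f e₃))

  swap-e₂e₃ : TriangularStar → TriangularStar
  swap-e₂e₃ (triangularStar v e₁ e₂ e₃ v₁ v₂ v₃ d₁₂ d₁₃ d₂₃ nc) =
    triangularStar v e₁ e₃ e₂ v₁ v₃ v₂ d₁₃ d₁₂ (≢-sym d₂₃) λ (x , x₁ , x₃ , x₂) → nc (x , x₁ , x₂ , x₃)

  rotate : TriangularStar → TriangularStar
  rotate (triangularStar v e₁ e₂ e₃ v₁ v₂ v₃ d₁₂ d₁₃ d₂₃ nc) =
    triangularStar v e₂ e₃ e₁ v₂ v₃ v₁ d₂₃ (≢-sym d₁₂) (≢-sym d₁₃) λ (x , x₂ , x₃ , x₁) → nc (x , x₁ , x₂ , x₃)

  module StarCase (s : TriangularStar) where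
    open TriangularStar s renaming (centre to v)

    u₁ u₂ u₃ : Fin (3 + k)
    u₁ = H.opposite centre∈e₁
    u₂ = H.opposite centre∈e₂
    u₃ = H.opposite centre∈e₃

    u₁∈e₁ : u₁ ∈H e₁
    u₁∈e₁ = H.opposite∈ centre∈e₁
    u₂∈e₂ : u₂ ∈H e₂
    u₂∈e₂ = H.opposite∈ centre∈e₂
    u₃∈e₃ : u₃ ∈H e₃
    u₃∈e₃ = H.opposite∈ centre∈e₃

    v≢u₁ : v ≢ u₁
    v≢u₁ = ≢-sym (H.opposite≢ centre∈e₁)
    v≢u₂ : v ≢ u₂
    v≢u₂ = ≢-sym (H.opposite≢ centre∈e₂)
    v≢u₃ : v ≢ u₃
    v≢u₃ = ≢-sym (H.opposite≢ centre∈e₃)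

    u₁≢u₂ : u₁ ≢ u₂
    u₁≢u₂ = H.opposites-≢ centre∈e₁ centre∈e₂ e₁≢e₂
    u₁≢u₃ : u₁ ≢ u₃
    u₁≢u₃ = H.opposites-≢ centre∈e₁ centre∈e₃ e₁≢e₃
    u₂≢u₃ : u₂ ≢ u₃
    u₂≢u₃ = H.opposites-≢ centre∈e₂ centre∈e₃ e₂≢e₃

    tri : G.Triangle (f e₁) (f e₂) (f e₃)
    tri = G.triangle-of-pairwise-Share (f-≢ e₁≢e₂) (f-Share (v , centre∈e₁ , centre∈e₂))
            (f-Share (v , centre∈e₁ , centre∈e₃)) (f-Share (v , centre∈e₂ , centre∈e₃)) images-no-common

    open G.Triangle tri

    star-edges : ∀ {x} → v ∈H x → x ≡ e₁ ⊎ x ≡ e₂ ⊎ x ≡ e₃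
    star-edges v∈x = Sum.map f-injective (Sum.map f-injective f-injective)
      (meets-all-sides⇒side (f-Share (v , v∈x , centre∈e₁)) (f-Share (v , v∈x , centre∈e₂))
                            (f-Share (v , v∈x , centre∈e₃)))

    star-vertex : Fin 4 → Fin (3 + k)
    star-vertex zero                   = v
    star-vertex (suc zero)             = u₁
    star-vertex (suc (suc zero))       = u₂
    star-vertex (suc (suc (suc zero))) = u₃

    no-edge-leaves-star : ∀ i {b} → (∀ j → star-vertex j ≢ b) → adj H (star-vertex i) b ≡ true → ⊥
    no-edge-leaves-star i {b} outside ab with H.edge-through ab
    no-edge-leaves-star zero {b} outside ab | x , v∈x , b∈x =
      [ x≢ centre∈e₁ (outside (suc zero)) , [ x≢ centre∈e₂ (outside (suc (suc zero)))
                                            , x≢ centre∈e₃ (outside (suc (suc (suc zero)))) ] ] (star-edges v∈x)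
      where
        x≢ : ∀ {e} (p : v ∈H e) → H.opposite p ≢ b → x ≢ e
        x≢ p u≢b refl = H.∉-of-≢ p (H.opposite∈ p) (≢-sym (H.opposite≢ p)) (≢-sym (outside zero)) (≢-sym u≢b) b∈x
    no-edge-leaves-star (suc zero) outside ab | x , u₁∈x , b∈x =
      ¬meets-only-E₁ (f-Share (u₁ , u₁∈x , u₁∈e₁))
        (f-¬Share (H.¬Share-of-≢ u₁∈x b∈x (H.adj⇒≢ ab) centre∈e₂ u₂∈e₂ v≢u₂
                                 v≢u₁ (outside zero) (≢-sym u₁≢u₂) (outside (suc (suc zero)))))
        (f-¬Share (H.¬Share-of-≢ u₁∈x b∈x (H.adj⇒≢ ab) centre∈e₃ u₃∈e₃ v≢u₃
                                 v≢u₁ (outside zero) (≢-sym u₁≢u₃) (outside (suc (suc (suc zero))))))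
    no-edge-leaves-star (suc (suc zero)) outside ab | x , u₂∈x , b∈x =
      G.Triangle.¬meets-only-E₁ (G.swap₁₂ tri) (f-Share (u₂ , u₂∈x , u₂∈e₂))
        (f-¬Share (H.¬Share-of-≢ u₂∈x b∈x (H.adj⇒≢ ab) centre∈e₁ u₁∈e₁ v≢u₁
                                 v≢u₂ (outside zero) u₁≢u₂ (outside (suc zero))))
        (f-¬Share (H.¬Share-of-≢ u₂∈x b∈x (H.adj⇒≢ ab) centre∈e₃ u₃∈e₃ v≢u₃
                                 v≢u₂ (outside zero) (≢-sym u₂≢u₃) (outside (suc (suc (suc zero))))))
    no-edge-leaves-star (suc (suc (suc zero))) outside ab | x , u₃∈x , b∈x =
      G.Triangle.¬meets-only-E₁ (G.swap₁₃ tri) (f-Share (u₃ , u₃∈x , u₃∈e₃))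
        (f-¬Share (H.¬Share-of-≢ u₃∈x b∈x (H.adj⇒≢ ab) centre∈e₂ u₂∈e₂ v≢u₂
                                 v≢u₃ (outside zero) u₂≢u₃ (outside (suc (suc zero)))))
        (f-¬Share (H.¬Share-of-≢ u₃∈x b∈x (H.adj⇒≢ ab) centre∈e₁ u₁∈e₁ v≢u₁
                                 v≢u₃ (outside zero) u₁≢u₃ (outside (suc zero))))

    star-spans : ∀ z → ∃[ i ] star-vertex i ≡ z
    star-spans z = walk-closed H closed (connected v z) (zero , refl)
      where
        closed : ∀ {a b} → ∃[ i ] star-vertex i ≡ a → adj H a b ≡ true → ∃[ i ] star-vertex i ≡ b
        closed {b = b} (i , refl) ab with any? (λ j → star-vertex j ≟ b)
        ... | yes spanned = spanned
        ... | no ¬spanned = ⊥-elim (no-edge-leaves-star i (λ j eq → ¬spanned (j , eq)) ab)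

    claw⇒J≅JC₃ : adj H u₁ u₂ ≢ true → adj H u₁ u₃ ≢ true → adj H u₂ u₃ ≢ true → J H ≅ J C₃
    claw⇒J≅JC₃ ¬u₁u₂ ¬u₁u₃ ¬u₂u₃ = J≅JC₃ (record
      { e₁ = e₁ ; e₂ = e₂ ; e₃ = e₃ ; e₁≢e₂ = e₁≢e₂ ; e₁≢e₃ = e₁≢e₃ ; e₂≢e₃ = e₂≢e₃
      ; Share₁₂ = v , centre∈e₁ , centre∈e₂ ; Share₁₃ = v , centre∈e₁ , centre∈e₃
      ; Share₂₃ = v , centre∈e₂ , centre∈e₃
      ; all-edges = all-edges })
      where
        leaves-nonadjacent : ∀ i j → adj H (star-vertex (suc i)) (star-vertex (suc j)) ≢ true
        leaves-nonadjacent zero             (suc zero)       = ¬u₁u₂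
        leaves-nonadjacent zero             (suc (suc zero)) = ¬u₁u₃
        leaves-nonadjacent (suc zero)       (suc (suc zero)) = ¬u₂u₃
        leaves-nonadjacent (suc zero)       zero             = ¬u₁u₂ ∘ H.adj-sym
        leaves-nonadjacent (suc (suc zero)) zero             = ¬u₁u₃ ∘ H.adj-sym
        leaves-nonadjacent (suc (suc zero)) (suc zero)       = ¬u₂u₃ ∘ H.adj-sym
        leaves-nonadjacent zero             zero             p = H.adj⇒≢ p refl
        leaves-nonadjacent (suc zero)       (suc zero)       p = H.adj⇒≢ p refl
        leaves-nonadjacent (suc (suc zero)) (suc (suc zero)) p = H.adj⇒≢ p refl

        all-edges : ∀ x → x ≡ e₁ ⊎ x ≡ e₂ ⊎ x ≡ e₃
        all-edges x with star-spans (H.lower x) | star-spans (H.upper x)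
        ... | zero , p  | _         = star-edges (H.at-lower p)
        ... | _         | zero , q  = star-edges (H.at-upper q)
        ... | suc i , p | suc j , q =
          ⊥-elim (leaves-nonadjacent i j (subst₂ (λ a b → adj H a b ≡ true) (sym p) (sym q) (H.lower-adj-upper x)))

    -- f L is a pendant edge a₃ x of the triangle, and x is where u₃ goes.
    embedding-via-u₁u₂ : adj H u₁ u₂ ≡ true → IsSubgraph H G
    embedding-via-u₁u₂ u₁u₂ with H.edge-through u₁u₂
    ... | L , u₁∈L , u₂∈L =
      subgraph-by-enumeration {A = H} {B = G} star-vertex image star-spans reflects transfer
      where
        fL-misses-e₃ : ¬ G.Share (f L) (f e₃)
        fL-misses-e₃ = f-¬Share (H.¬Share-of-≢ u₁∈L u₂∈L u₁≢u₂ centre∈e₃ u₃∈e₃ v≢u₃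
                                              v≢u₁ v≢u₂ (≢-sym u₁≢u₃) (≢-sym u₂≢u₃))

        a₃∈fL : a₃ ∈G f L
        a₃∈fL = through-a₃ (f-Share (u₁ , u₁∈L , u₁∈e₁)) fL-misses-e₃

        x : Fin n
        x = G.opposite a₃∈fL

        x∈fL : x ∈G f L
        x∈fL = G.opposite∈ a₃∈fL

        x≢a₃ : x ≢ a₃
        x≢a₃ = G.opposite≢ a₃∈fL

        x≢a₁ : x ≢ a₁
        x≢a₁ eq = fL-misses-e₃ (x , x∈fL , subst (_∈G f e₃) (sym eq) a₁∈E₃)

        x≢a₂ : x ≢ a₂
        x≢a₂ eq = fL-misses-e₃ (x , x∈fL , subst (_∈G f e₃) (sym eq) a₂∈E₃)

        adjacent-to-x : ∀ {L' q} → G.Share (f L') (f L) → a₃ ∉G f L' → q ∈G f L' → q ≢ x → adj G q x ≡ true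
        adjacent-to-x S a₃∉ q∈ q≢x = G.endpoints-adjacent q∈ (G.Share-∉⇒∈ S a₃∈fL x∈fL (≢-sym x≢a₃) a₃∉) q≢x

        a₂-adj-x : adj H u₁ u₃ ≡ true → adj G a₂ x ≡ true
        a₂-adj-x u₁u₃ with H.edge-through u₁u₃
        ... | L' , u₁∈L' , u₃∈L' =
          adjacent-to-x (f-Share (u₁ , u₁∈L' , u₁∈L)) (λ a₃∈ → misses-e₂ (a₃ , a₃∈ , a₃∈E₂))
            (G.Triangle.through-a₃ (G.swap₂₃ tri) (f-Share (u₁ , u₁∈L' , u₁∈e₁)) misses-e₂) (≢-sym x≢a₂)
          where
            misses-e₂ : ¬ G.Share (f L') (f e₂)
            misses-e₂ = f-¬Share (H.¬Share-of-≢ u₁∈L' u₃∈L' u₁≢u₃ centre∈e₂ u₂∈e₂ v≢u₂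
                                               v≢u₁ v≢u₃ (≢-sym u₁≢u₂) u₂≢u₃)

        a₁-adj-x : adj H u₂ u₃ ≡ true → adj G a₁ x ≡ true
        a₁-adj-x u₂u₃ with H.edge-through u₂u₃
        ... | L' , u₂∈L' , u₃∈L' =
          adjacent-to-x (f-Share (u₂ , u₂∈L' , u₂∈L)) (λ a₃∈ → misses-e₁ (a₃ , a₃∈ , a₃∈E₁))
            (G.Triangle.through-a₃ (G.swap₂₃ (G.swap₁₂ tri)) (f-Share (u₂ , u₂∈L' , u₂∈e₂)) misses-e₁)
            (≢-sym x≢a₁)
          where
            misses-e₁ : ¬ G.Share (f L') (f e₁)
            misses-e₁ = f-¬Share (H.¬Share-of-≢ u₂∈L' u₃∈L' u₂≢u₃ centre∈e₁ u₁∈e₁ v≢u₁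
                                               v≢u₂ v≢u₃ u₁≢u₂ u₁≢u₃)

        image : Fin 4 → Fin n
        image zero                   = a₃
        image (suc zero)             = a₂
        image (suc (suc zero))       = a₁
        image (suc (suc (suc zero))) = x

        reflects : ∀ i j → image i ≡ image j → star-vertex i ≡ star-vertex j
        reflects zero                    zero                    _  = refl
        reflects zero                    (suc zero)              eq = ⊥-elim (a₂≢a₃ (sym eq))
        reflects zero                    (suc (suc zero))        eq = ⊥-elim (a₁≢a₃ (sym eq))
        reflects zero                    (suc (suc (suc zero)))  eq = ⊥-elim (x≢a₃ (sym eq))
        reflects (suc zero)              zero                    eq = ⊥-elim (a₂≢a₃ eq)
        reflects (suc zero)              (suc zero)              _  = refl
        reflects (suc zero)              (suc (suc zero))        eq = ⊥-elim (a₁≢a₂ (sym eq))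
        reflects (suc zero)              (suc (suc (suc zero)))  eq = ⊥-elim (x≢a₂ (sym eq))
        reflects (suc (suc zero))        zero                    eq = ⊥-elim (a₁≢a₃ eq)
        reflects (suc (suc zero))        (suc zero)              eq = ⊥-elim (a₁≢a₂ eq)
        reflects (suc (suc zero))        (suc (suc zero))        _  = refl
        reflects (suc (suc zero))        (suc (suc (suc zero)))  eq = ⊥-elim (x≢a₁ (sym eq))
        reflects (suc (suc (suc zero)))  zero                    eq = ⊥-elim (x≢a₃ eq)
        reflects (suc (suc (suc zero)))  (suc zero)              eq = ⊥-elim (x≢a₂ eq)
        reflects (suc (suc (suc zero)))  (suc (suc zero))        eq = ⊥-elim (x≢a₁ eq)
        reflects (suc (suc (suc zero)))  (suc (suc (suc zero)))  _  = refl

        transfer : ∀ i j → adj H (star-vertex i) (star-vertex j) ≡ true → adj G (image i) (image j) ≡ true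
        transfer zero                   (suc zero)             _ = G.endpoints-adjacent a₃∈E₁ a₂∈E₁ (≢-sym a₂≢a₃)
        transfer zero                   (suc (suc zero))       _ = G.endpoints-adjacent a₃∈E₂ a₁∈E₂ (≢-sym a₁≢a₃)
        transfer zero                   (suc (suc (suc zero))) _ = G.endpoints-adjacent a₃∈fL x∈fL (≢-sym x≢a₃)
        transfer (suc zero)             (suc (suc zero))       _ = G.endpoints-adjacent a₂∈E₃ a₁∈E₃ (≢-sym a₁≢a₂)
        transfer (suc zero)             (suc (suc (suc zero))) p = a₂-adj-x p
        transfer (suc (suc zero))       (suc (suc (suc zero))) p = a₁-adj-x p
        transfer (suc zero)             zero                   p =
          G.adj-sym (transfer zero (suc zero) (H.adj-sym p))
        transfer (suc (suc zero))       zero                   p =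
          G.adj-sym (transfer zero (suc (suc zero)) (H.adj-sym p))
        transfer (suc (suc (suc zero))) zero                   p =
          G.adj-sym (transfer zero (suc (suc (suc zero))) (H.adj-sym p))
        transfer (suc (suc zero))       (suc zero)             p =
          G.adj-sym (transfer (suc zero) (suc (suc zero)) (H.adj-sym p))
        transfer (suc (suc (suc zero))) (suc zero)             p =
          G.adj-sym (transfer (suc zero) (suc (suc (suc zero))) (H.adj-sym p))
        transfer (suc (suc (suc zero))) (suc (suc zero))       p =
          G.adj-sym (transfer (suc (suc zero)) (suc (suc (suc zero))) (H.adj-sym p))
        transfer zero                   zero                   p = ⊥-elim (H.adj⇒≢ p refl)
        transfer (suc zero)             (suc zero)             p = ⊥-elim (H.adj⇒≢ p refl)
        transfer (suc (suc zero))       (suc (suc zero))       p = ⊥-elim (H.adj⇒≢ p refl)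
        transfer (suc (suc (suc zero))) (suc (suc (suc zero))) p = ⊥-elim (H.adj⇒≢ p refl)

  triangularStar⇒subgraph : TriangularStar → IsSubgraph H G
  triangularStar⇒subgraph s with adj H u₁ u₂ ≟ᵇ true | adj H u₁ u₃ ≟ᵇ true | adj H u₂ u₃ ≟ᵇ true
    where open StarCase s
  ... | yes u₁u₂ | _        | _        = StarCase.embedding-via-u₁u₂ s u₁u₂
  ... | no _     | yes u₁u₃ | _        = StarCase.embedding-via-u₁u₂ (swap-e₂e₃ s) u₁u₃
  ... | no _     | no _     | yes u₂u₃ = StarCase.embedding-via-u₁u₂ (rotate s) u₂u₃
  ... | no ¬u₁u₂ | no ¬u₁u₃ | no ¬u₂u₃ = ⊥-elim (J≇JC₃ (StarCase.claw⇒J≅JC₃ s ¬u₁u₂ ¬u₁u₃ ¬u₂u₃))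

  module ConcurrentStars (concurrent : ¬ TriangularStar) where

    concurrent-image : ∀ {v e e' e'' w} → v ∈H e → v ∈H e' → v ∈H e'' → e ≢ e' →
                       w ∈G f e → w ∈G f e' → w ∈G f e''
    concurrent-image {v} {e} {e'} {e''} {w} ve ve' ve'' e≢e' we we' with w ∈G? f e''
    ... | yes we'' = we''
    ... | no w∉e'' = ⊥-elim (concurrent (triangularStar v e e' e'' ve ve' ve'' e≢e'
          (λ { refl → w∉e'' we }) (λ { refl → w∉e'' we' })
          λ (y , ye , ye' , ye'') →
            w∉e'' (subst (_∈G f e'') (G.common-endpoint-unique (f-≢ e≢e') ye ye' we we') ye'')))

    no-edge-at-a₃ : ∀ {E₁ E₂ E₃ w b} (T : H.Triangle E₁ E₂ E₃) →
                    w ∈G f E₁ → w ∈G f E₂ → w ∈G f E₃ →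
                    adj H (H.Triangle.a₃ T) b ≡ true → b ≢ H.Triangle.a₁ T → b ≢ H.Triangle.a₂ T → ⊥
    no-edge-at-a₃ {w = w} T w₁ w₂ w₃ a₃b b≢a₁ b≢a₂ with H.edge-through a₃b
    ... | X , a₃∈X , b∈X =
      H.¬Share-of-≢ a₃∈X b∈X (H.adj⇒≢ a₃b) a₁∈E₃ a₂∈E₃ a₁≢a₂ a₁≢a₃ (≢-sym b≢a₁) a₂≢a₃ (≢-sym b≢a₂)
        (f-Share⁻¹ (w , concurrent-image a₃∈E₁ a₃∈E₂ a₃∈X E₁≢E₂ w₁ w₂ , w₃))
      where open H.Triangle T

    -- An edge leaving the triangle at a corner meets, by concurrency there, the opposite side;
    -- so H is the triangle itself.
    ¬concurrent-triangle : ∀ {E₁ E₂ E₃ w} (T : H.Triangle E₁ E₂ E₃) →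
                           w ∈G f E₁ → w ∈G f E₂ → w ∈G f E₃ → ⊥
    ¬concurrent-triangle T w₁ w₂ w₃ =
      J≇JC₃ (J≅JC₃ (H.triangle⇒ThreeMeetingEdges T λ z → walk-closed H closed (connected a₁ z) (inj₁ refl)))
      where
        open H.Triangle T
        closed : ∀ {a b} → Corner a → adj H a b ≡ true → Corner b
        closed {b = b} a-corner ab with corner? b
        ... | yes b-corner = b-corner
        ... | no b-outside with a-corner
        ...   | inj₁ refl        = ⊥-elim (no-edge-at-a₃ (H.swap₁₃ T) w₃ w₂ w₁ ab
                                                         (b-outside ∘ inj₂ ∘ inj₂) (b-outside ∘ inj₂ ∘ inj₁))
        ...   | inj₂ (inj₁ refl) = ⊥-elim (no-edge-at-a₃ (H.swap₂₃ T) w₁ w₃ w₂ ab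
                                                         (b-outside ∘ inj₁) (b-outside ∘ inj₂ ∘ inj₂))
        ...   | inj₂ (inj₂ refl) = ⊥-elim (no-edge-at-a₃ T w₁ w₂ w₃ ab
                                                         (b-outside ∘ inj₁) (b-outside ∘ inj₂ ∘ inj₁))

    Centre : Fin (3 + k) → Fin n → Set
    Centre v w = ∀ e → v ∈H e ⇔ w ∈G f e

    centre-of-branch : ∀ {v u u'} → adj H v u ≡ true → adj H v u' ≡ true → u' ≢ u → ∃ (Centre v)
    centre-of-branch {v} {u} {u'} vu vu' u'≢u with H.edge-through vu | H.edge-through vu'
    ... | e , ve , ue | e' , ve' , u'e' with f-Share (v , ve , ve')
    ... | w , we , we' = w , λ e'' → mk⇔ (λ ve'' → concurrent-image ve ve' ve'' e≢e' we we') (through-v e'')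
      where
        v≢u : v ≢ u
        v≢u = H.adj⇒≢ vu
        v≢u' : v ≢ u'
        v≢u' = H.adj⇒≢ vu'

        e≢e' : e ≢ e'
        e≢e' eq = H.∉-of-≢ ve ue v≢u (≢-sym v≢u') u'≢u (subst (u' H.∈ₑ_) (sym eq) u'e')

        through-v : ∀ e'' → w ∈G f e'' → v ∈H e''
        through-v e'' we'' with v ∈H? e''
        ... | yes ve'' = ve''
        ... | no v∉e'' = ⊥-elim (¬concurrent-triangle triangle we'' we' we)
          where
            triangle : H.Triangle e'' e' e
            triangle = record
              { a₁ = v ; a₂ = u ; a₃ = u'
              ; a₁≢a₂ = v≢u ; a₁≢a₃ = v≢u' ; a₂≢a₃ = ≢-sym u'≢u
              ; a₂∈E₁ = H.Share-∉⇒∈ (f-Share⁻¹ (w , we'' , we)) ve ue v≢u v∉e''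
              ; a₃∈E₁ = H.Share-∉⇒∈ (f-Share⁻¹ (w , we'' , we')) ve' u'e' v≢u' v∉e''
              ; a₁∈E₂ = ve' ; a₃∈E₂ = u'e' ; a₁∈E₃ = ve ; a₂∈E₃ = ue }

    other-neighbour : ∀ {v u} → (∀ {t} → adj H v t ≡ true → t ≡ u) → ∃[ y ] adj H u y ≡ true × y ≢ v
    other-neighbour {v} {u} only-u with third v u
    ... | z , z≢v , z≢u with leave-pair (connected v z) z≢v z≢u
    ...   | _ , y , inj₁ refl , (_ , y≢u) , xy = ⊥-elim (y≢u (only-u xy))
    ...   | _ , y , inj₂ refl , (y≢v , _) , xy = y , xy , y≢v

    centre-of-pendant : ∀ {v u} → adj H v u ≡ true → (∀ {t} → adj H v t ≡ true → t ≡ u) → ∃ (Centre v)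
    centre-of-pendant {v} {u} vu only-u with other-neighbour only-u | H.edge-through vu
    ... | y , uy , y≢v | e , ve , ue with H.edge-through uy
    ... | e' , ue' , ye' with f-Share (u , ue , ue')
    ... | c , ce , ce' = G.opposite ce , λ e'' → mk⇔ (λ ve'' → subst (λ e → w ∈G f e) (sym (only-e ve'')) we)
                                                      (through-v e'')
      where
        w : Fin n
        w = G.opposite ce
        we : w ∈G f e
        we = G.opposite∈ ce

        v≢u : v ≢ u
        v≢u = H.adj⇒≢ vu

        e≢e' : e ≢ e'
        e≢e' eq = H.∉-of-≢ ue' ye' (H.adj⇒≢ uy) v≢u (≢-sym y≢v) (subst (v H.∈ₑ_) eq ve)

        only-e : ∀ {e''} → v ∈H e'' → e'' ≡ e
        only-e ve'' = H.edge-unique v≢u ve''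
          (subst (H._∈ₑ _) (only-u (H.endpoints-adjacent ve'' (H.opposite∈ ve'') (≢-sym (H.opposite≢ ve''))))
                 (H.opposite∈ ve''))
          ve ue

        -- An edge e'' ∌ v with w ∈ f e'' meets e at u, so by concurrency at u also c ∈ f e'';
        -- then f e'' = f e.
        through-v : ∀ e'' → w ∈G f e'' → v ∈H e''
        through-v e'' we'' with v ∈H? e''
        ... | yes ve'' = ve''
        ... | no v∉e'' = ⊥-elim (v∉e'' (subst (v H.∈ₑ_) (sym (f-injective fe''≡fe)) ve))
          where
            ue'' : u ∈H e''
            ue'' = H.Share-∉⇒∈ (f-Share⁻¹ (w , we'' , we)) ve ue v≢u v∉e''
            fe''≡fe : f e'' ≡ f e
            fe''≡fe = G.edge-unique (≢-sym (G.opposite≢ ce)) (concurrent-image ue ue' ue'' e≢e' ce ce') we'' ce we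

    centre : ∀ v → ∃ (Centre v)
    centre v with third v v
    ... | z , z≢v , _ with first-step H (connected v z) (≢-sym z≢v)
    ... | u , vu with any? (λ u' → (adj H v u' ≟ᵇ true) ×-dec ¬? (u' ≟ u))
    ... | yes (u' , vu' , u'≢u) = centre-of-branch vu vu' u'≢u
    ... | no no-other = centre-of-pendant vu only-u
      where
        only-u : ∀ {t} → adj H v t ≡ true → t ≡ u
        only-u {t} vt with t ≟ u
        ... | yes t≡u = t≡u
        ... | no t≢u = ⊥-elim (no-other (t , vt , t≢u))

    shared-centre⇒neighbour : ∀ {a a' w y} → Centre a w → Centre a' w → a ≢ a' → adj H a y ≡ true → y ≡ a'
    shared-centre⇒neighbour Ca Ca' a≢a' ay with H.edge-through ay
    ... | e , ae , ye
      with H.endpoint-cases ae ye (H.adj⇒≢ ay) (Equivalence.from (Ca' e) (Equivalence.to (Ca e) ae))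
    ...   | inj₁ a'≡a = ⊥-elim (a≢a' (sym a'≡a))
    ...   | inj₂ a'≡y = sym a'≡y

    centre-unique : ∀ {v v' w} → Centre v w → Centre v' w → v ≡ v'
    centre-unique {v} {v'} Cv Cv' with v ≟ v'
    ... | yes v≡v' = v≡v'
    ... | no v≢v' with third v v'
    ...   | z , z≢v , z≢v' with leave-pair (connected v z) z≢v z≢v'
    ...     | _ , y , inj₁ refl , (_ , y≢v') , xy = ⊥-elim (y≢v' (shared-centre⇒neighbour Cv Cv' v≢v' xy))
    ...     | _ , y , inj₂ refl , (y≢v , _) , xy = ⊥-elim (y≢v (shared-centre⇒neighbour Cv' Cv (≢-sym v≢v') xy))

    embedding : IsSubgraph H G
    embedding = g , g-injective , g-adj
      where
        g : Fin (3 + k) → Fin n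
        g = proj₁ ∘ centre

        g-injective : Injective _≡_ _≡_ g
        g-injective {x} {y} gx≡gy =
          centre-unique (proj₂ (centre x)) (subst (Centre y) (sym gx≡gy) (proj₂ (centre y)))

        g-adj : ∀ x y → adj H x y ≡ true → adj G (g x) (g y) ≡ true
        g-adj x y xy with H.edge-through xy
        ... | e , xe , ye = G.endpoints-adjacent (Equivalence.to (proj₂ (centre x) e) xe)
                                                 (Equivalence.to (proj₂ (centre y) e) ye)
                                                 (H.adj⇒≢ xy ∘ g-injective)

  subgraph : IsSubgraph H G
  subgraph = by-cases triangularStar?
    where
      by-cases : Dec TriangularStar → IsSubgraph H G
      by-cases (yes s) = triangularStar⇒subgraph s
      by-cases (no ¬s) = ConcurrentStars.embedding ¬s

mainTheorem8 : ∀ {m n} (H : FinGraph m) (G : FinGraph n) →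
    Connected H → Connected G →
    ¬ (J G ≅ J C₃) → ¬ (J H ≅ J C₃) →
    IsInducedSubgraph (J H) (J G) → IsSubgraph H G
mainTheorem8 {zero}                H G _           _       _ _     _ = subgraph-of-empty H G
mainTheorem8 {suc zero}            H G _           (w , _) _ _     _ = subgraph-of-single H G w
mainTheorem8 {suc (suc zero)}      H G (_ , walks) _       _ _     (f , _) =
  subgraph-of-pair H G (f (proj₁ (Edges.edge-through H (proj₂ (first-step H (walks zero (suc zero)) λ ())))))
mainTheorem8 {suc (suc (suc _))}   H G (_ , walks) _       _ J≇JC₃ (f , f-injective , f-adj) =
  Reconstruction.subgraph H G walks J≇JC₃ f f-injective f-adj
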